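{- Let $B(z) = \frac{1 - \sqrt{1 - 4z}}{2z}$ be the generating function of binary trees counted by the number of inner nodes. Then, as an identity of power series (equivalently, of analytic functions in a neighborhood of $0$), \[ B(z)=1+\frac{z}{1-2z}\,B\Big(\frac{z^2}{(1-2z)^2}\Big). \]
   Context: A binary tree is either a leaf $\square$ or an inner node (root) with an ordered pair (left, right) of binary subtrees. The size of a binary tree is its number of inner nodes; the number of binary trees of size $n$ is the Catalan number $C_n=\frac{1}{n+1}\binom{2n}{n}$, and $B(z)=\sum_{n\ge0}C_nz^n$. -}

module Defs where

open import Data.Nat as ℕ using (ℕ; zero; suc; _∸_)
open import Data.Nat.Combinatorics using (_C_)
open import Data.Integer using (ℤ; +_; -_; _+_; _*_)

Series : Set
Series = ℕ → ℤ

sumTo : ℕ → (ℕ → ℤ) → ℤ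
sumTo zero    f = f zero
sumTo (suc n) f = sumTo n f + f (suc n)

one : Series
one zero    = + 1
one (suc _) = + 0

X : Series
X (suc zero) = + 1
X _          = + 0

oneMinus2z : Series
oneMinus2z zero          = + 1
oneMinus2z (suc zero)    = - (+ 2)
oneMinus2z (suc (suc _)) = + 0

_⊕_ : Series → Series → Series
(f ⊕ g) n = f n + g n

_⊛_ : Series → Series → Series
(f ⊛ g) n = sumTo n (λ i → f i * g (n ∸ i))

infixl 6 _⊕_
infixl 7 _⊛_

pow : Series → ℕ → Series
pow f zero    = one
pow f (suc k) = f ⊛ pow f k

-- Composition F(G(z)), meaningful for G with zero constant term:
-- then G^k has no coefficients below z^k, so [z^n] F(G) = Σ_{k ≤ n} F_k [z^n] G^k.
compose : Series → Series → Series
compose F G n = sumTo n (λ k → F k * pow G k n)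

catalan : ℕ → ℕ
catalan n = ((2 ℕ.* n) C n) ℕ./ suc n

B : Series
B n = + catalan n

-- If Y = 1 + zY², differentiating and eliminating Y² gives z(1 - 4z)Y' + (1 - 2z)Y = 1,
-- i.e. Y₀ = 1 and (n + 2)Y_{n+1} = (4n + 2)Y_n.  The binomial formula for the Catalan numbers
-- obeys the same recurrence, so B is the only such series, and B is one because Segner's
-- recurrence produces a solution.  Substituting G = z²/(1 - 2z)², which has no constant term,
-- is a ring homomorphism, so u = B(G) satisfies u = 1 + Gu².  With I = 1/(1 - 2z) = 1 + 2zI,
-- T = 1 + zIu then satisfies T = 1 + zT² by a polynomial computation, hence T = B.
module Submission where

open import Defs
open import Relation.Binary.PropositionalEquality using (_≡_)

module CatalanRecurrence where

  open import Data.Nat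
  open import Data.Nat.Properties
  open import Data.Nat.Combinatorics using (_C_; nCk≡n!/k![n-k]!; k![n∸k]!∣n!)
  open import Data.Nat.DivMod using (_/_; m/n*n≡m; m*n/n≡m)
  open import Data.Nat.Tactic.RingSolver using (solve-∀)
  open import Relation.Binary.PropositionalEquality using (refl; sym; trans; cong; module ≡-Reasoning)
  open ≡-Reasoning

  nCk*k![n∸k]!≡n! : ∀ {n k} → k ≤ n → (n C k) * (k ! * (n ∸ k) !) ≡ n !
  nCk*k![n∸k]!≡n! {n} {k} k≤n = trans (cong (_* (k ! * (n ∸ k) !)) (nCk≡n!/k![n-k]! k≤n))
    (m/n*n≡m {{k !* (n ∸ k) !≢0}} (k![n∸k]!∣n! k≤n))

  central : ℕ → ℕ
  central n = (2 * n) C n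

  central*n!*n!≡[2n]! : ∀ n → central n * (n ! * n !) ≡ (2 * n) !
  central*n!*n!≡[2n]! n = begin
    central n * (n ! * n !)               ≡⟨ cong (λ m → central n * (n ! * m !)) (sym 2n∸n≡n) ⟩
    central n * (n ! * (2 * n ∸ n) !)     ≡⟨ nCk*k![n∸k]!≡n! (m≤m+n n (n + 0)) ⟩
    (2 * n) !                             ∎
    where
    2n∸n≡n : 2 * n ∸ n ≡ n
    2n∸n≡n = trans (m+n∸m≡n n (n + 0)) (+-identityʳ n)

  [1+n]*[2n]C[1+n]≡n*central : ∀ n → suc n * ((2 * n) C suc n) ≡ n * central n
  [1+n]*[2n]C[1+n]≡n*central zero = refl
  [1+n]*[2n]C[1+n]≡n*central n@(suc m) =
    *-cancelʳ-≡ _ _ (n ! * m !) {{m*n≢0 (n !) (m !) {{n !≢0}} {{m !≢0}}}} (begin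
      suc n * c′ * (n ! * m !)                 ≡⟨ move-left (suc n) c′ (n !) (m !) ⟩
      c′ * (suc n ! * m !)                     ≡⟨ cong (λ k → c′ * (suc n ! * k !)) (sym 2n∸[1+n]≡m) ⟩
      c′ * (suc n ! * (2 * n ∸ suc n) !)       ≡⟨ nCk*k![n∸k]!≡n! (≤-trans (m≤m+n (suc n) m) (≤-reflexive 2+2m≡2n)) ⟩
      (2 * n) !                                ≡⟨ sym (central*n!*n!≡[2n]! n) ⟩
      central n * (n ! * (n * m !))            ≡⟨ move-right (central n) n (n !) (m !) ⟩
      n * central n * (n ! * m !)              ∎)
    where
    c′ = (2 * n) C suc n
    2+2m≡2n : suc n + m ≡ 2 * n
    2+2m≡2n = [2+m]+m≡2[1+m] m
      where [2+m]+m≡2[1+m] : ∀ m → suc (suc m) + m ≡ 2 * suc m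
            [2+m]+m≡2[1+m] = solve-∀
    2n∸[1+n]≡m : 2 * n ∸ suc n ≡ m
    2n∸[1+n]≡m = trans (cong (_∸ suc n) (sym 2+2m≡2n)) (m+n∸m≡n (suc n) m)
    move-left : ∀ a x f g → a * x * (f * g) ≡ x * (a * f * g)
    move-left = solve-∀
    move-right : ∀ x a f g → x * (f * (a * g)) ≡ a * x * (f * g)
    move-right = solve-∀

  [1+n]*central[1+n]≡2[1+2n]*central : ∀ n → suc n * central (suc n) ≡ 2 * (2 * n + 1) * central n
  [1+n]*central[1+n]≡2[1+2n]*central n =
    *-cancelʳ-≡ _ _ (suc n * n ! * n !) {{m*n≢0 (suc n !) (n !) {{suc n !≢0}} {{n !≢0}}}} (begin
      suc n * central (suc n) * (suc n * n ! * n !)            ≡⟨ move-left n (central (suc n)) (n !) ⟩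
      central (suc n) * (suc n ! * suc n !)                    ≡⟨ central*n!*n!≡[2n]! (suc n) ⟩
      (2 * suc n) !                                            ≡⟨ cong _! (2[1+n]≡2+2n n) ⟩
      (2 + 2 * n) !                                            ≡⟨ cong (λ k → (2 + 2 * n) * ((1 + 2 * n) * k)) (sym (central*n!*n!≡[2n]! n)) ⟩
      (2 + 2 * n) * ((1 + 2 * n) * (central n * (n ! * n !)))  ≡⟨ move-right n (central n) (n !) ⟩
      2 * (2 * n + 1) * central n * (suc n * n ! * n !)        ∎)
    where
    2[1+n]≡2+2n : ∀ n → 2 * suc n ≡ 2 + 2 * n
    2[1+n]≡2+2n = solve-∀
    move-left : ∀ n x f → suc n * x * (suc n * f * f) ≡ x * ((suc n * f) * (suc n * f))
    move-left = solve-∀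
    move-right : ∀ n y f → (2 + 2 * n) * ((1 + 2 * n) * (y * (f * f))) ≡ 2 * (2 * n + 1) * y * (suc n * f * f)
    move-right = solve-∀

  central≡[1+n]*catalan : ∀ n → central n ≡ suc n * catalan n
  central≡[1+n]*catalan n = trans central≡[1+n]*q (cong (suc n *_) (sym catalan≡q))
    where
    q : ℕ
    q = central n ∸ (2 * n) C suc n
    central≡[1+n]*q : central n ≡ suc n * q
    central≡[1+n]*q = sym (begin
      suc n * q                                          ≡⟨ *-distribˡ-∸ (suc n) (central n) ((2 * n) C suc n) ⟩
      suc n * central n ∸ suc n * ((2 * n) C suc n)      ≡⟨ cong (suc n * central n ∸_) ([1+n]*[2n]C[1+n]≡n*central n) ⟩
      central n + n * central n ∸ n * central n          ≡⟨ m+n∸n≡m (central n) (n * central n) ⟩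
      central n                                          ∎)
    catalan≡q : catalan n ≡ q
    catalan≡q = trans (cong (_/ suc n) (trans central≡[1+n]*q (*-comm (suc n) q))) (m*n/n≡m q (suc n))

  catalan-recurrence : ∀ n → (2 + n) * catalan (suc n) ≡ (4 * n + 2) * catalan n
  catalan-recurrence n = *-cancelˡ-≡ _ _ (suc n) (begin
    suc n * ((2 + n) * catalan (suc n))     ≡⟨ cong (suc n *_) (sym (central≡[1+n]*catalan (suc n))) ⟩
    suc n * central (suc n)                 ≡⟨ [1+n]*central[1+n]≡2[1+2n]*central n ⟩
    2 * (2 * n + 1) * central n             ≡⟨ cong (2 * (2 * n + 1) *_) (central≡[1+n]*catalan n) ⟩
    2 * (2 * n + 1) * (suc n * catalan n)   ≡⟨ rearrange n (catalan n) ⟩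
    suc n * ((4 * n + 2) * catalan n)       ∎)
    where
    rearrange : ∀ n c → 2 * (2 * n + 1) * (suc n * c) ≡ suc n * ((4 * n + 2) * c)
    rearrange = solve-∀

open import Level using (0ℓ)
open import Data.Nat as ℕ using (ℕ; zero; suc; _∸_; _≤_; _<_; z≤n; s≤s)
import Data.Nat.Properties as ℕP
open import Data.Integer as ℤ using (ℤ; +_; -_; _+_; _*_)
import Data.Integer.Properties as ℤP
open import Data.Integer.Tactic.RingSolver using (solve-∀)
open import Data.Maybe using (Maybe; just; nothing)
open import Data.Product using (_,_)
open import Relation.Nullary using (yes; no)
open import Relation.Binary.PropositionalEquality using (refl; sym; trans; cong; cong₂; module ≡-Reasoning)
open import Algebra.Bundles using (CommutativeRing)
import Algebra.Solver.Ring.AlmostCommutativeRing as ACR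
import Relation.Binary.Reasoning.Setoid as SetoidReasoning
open CatalanRecurrence using (catalan-recurrence)

sumTo-cong : ∀ n {f g : ℕ → ℤ} → (∀ i → i ≤ n → f i ≡ g i) → sumTo n f ≡ sumTo n g
sumTo-cong zero    f≡g = f≡g 0 z≤n
sumTo-cong (suc n) f≡g = cong₂ _+_ (sumTo-cong n (λ i i≤n → f≡g i (ℕP.m≤n⇒m≤1+n i≤n))) (f≡g (suc n) ℕP.≤-refl)

sumTo-cong′ : ∀ n {f g : ℕ → ℤ} → (∀ i → f i ≡ g i) → sumTo n f ≡ sumTo n g
sumTo-cong′ n f≡g = sumTo-cong n (λ i _ → f≡g i)

sumTo-+ : ∀ n (f g : ℕ → ℤ) → sumTo n (λ i → f i + g i) ≡ sumTo n f + sumTo n g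
sumTo-+ zero    f g = refl
sumTo-+ (suc n) f g = trans (cong (_+ (f (suc n) + g (suc n))) (sumTo-+ n f g))
                            (interchange (sumTo n f) (sumTo n g) (f (suc n)) (g (suc n)))
  where
  interchange : ∀ a b c d → a + b + (c + d) ≡ a + c + (b + d)
  interchange = solve-∀

sumTo-*ˡ : ∀ n c (f : ℕ → ℤ) → c * sumTo n f ≡ sumTo n (λ i → c * f i)
sumTo-*ˡ zero    c f = refl
sumTo-*ˡ (suc n) c f = trans (ℤP.*-distribˡ-+ c (sumTo n f) (f (suc n))) (cong (_+ c * f (suc n)) (sumTo-*ˡ n c f))

sumTo-*ʳ : ∀ n c (f : ℕ → ℤ) → sumTo n f * c ≡ sumTo n (λ i → f i * c)
sumTo-*ʳ zero    c f = refl
sumTo-*ʳ (suc n) c f = trans (ℤP.*-distribʳ-+ c (sumTo n f) (f (suc n))) (cong (_+ f (suc n) * c) (sumTo-*ʳ n c f))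

sumTo-zero : ∀ n (f : ℕ → ℤ) → (∀ i → i ≤ n → f i ≡ + 0) → sumTo n f ≡ + 0
sumTo-zero n f f≡0 = trans (sumTo-cong n f≡0) (sumTo-const-0 n)
  where
  sumTo-const-0 : ∀ n → sumTo n (λ _ → + 0) ≡ + 0
  sumTo-const-0 zero    = refl
  sumTo-const-0 (suc n) = cong (_+ + 0) (sumTo-const-0 n)

sumTo-suc : ∀ n (f : ℕ → ℤ) → sumTo (suc n) f ≡ f 0 + sumTo n (λ i → f (suc i))
sumTo-suc zero    f = refl
sumTo-suc (suc n) f = trans (cong (_+ f (suc (suc n))) (sumTo-suc n f)) (ℤP.+-assoc (f 0) _ _)

sumTo-extend : ∀ {n} N (f : ℕ → ℤ) → n ≤ N → (∀ i → n < i → f i ≡ + 0) → sumTo N f ≡ sumTo n f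
sumTo-extend {n} N f n≤N f≡0 = trans (cong (λ m → sumTo m f) (sym (ℕP.m+[n∸m]≡n n≤N))) (pad (N ∸ n))
  where
  pad : ∀ d → sumTo (n ℕ.+ d) f ≡ sumTo n f
  pad zero    = cong (λ m → sumTo m f) (ℕP.+-identityʳ n)
  pad (suc d) rewrite ℕP.+-suc n d =
    trans (cong₂ _+_ (pad d) (f≡0 (suc (n ℕ.+ d)) (s≤s (ℕP.m≤m+n n d)))) (ℤP.+-identityʳ _)

sumTo-head : ∀ n (f : ℕ → ℤ) → (∀ i → f (suc i) ≡ + 0) → sumTo n f ≡ f 0
sumTo-head n f f≡0 = sumTo-extend n f z≤n λ { (suc i) _ → f≡0 i }

sumTo-reverse : ∀ n (f : ℕ → ℤ) → sumTo n f ≡ sumTo n (λ i → f (n ∸ i))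
sumTo-reverse zero    f = refl
sumTo-reverse (suc n) f = begin
  sumTo n f + f (suc n)                          ≡⟨ cong (_+ f (suc n)) (sumTo-reverse n f) ⟩
  sumTo n (λ i → f (n ∸ i)) + f (suc n)          ≡⟨ ℤP.+-comm _ (f (suc n)) ⟩
  f (suc n) + sumTo n (λ i → f (suc n ∸ suc i))  ≡⟨ sym (sumTo-suc n (λ i → f (suc n ∸ i))) ⟩
  sumTo (suc n) (λ i → f (suc n ∸ i))            ∎
  where open ≡-Reasoning

sumTo-swap : ∀ n m (a : ℕ → ℕ → ℤ) →
             sumTo n (λ i → sumTo m (λ j → a i j)) ≡ sumTo m (λ j → sumTo n (λ i → a i j))
sumTo-swap zero    m a = refl
sumTo-swap (suc n) m a = trans (cong (_+ sumTo m (a (suc n))) (sumTo-swap n m a))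
                               (sym (sumTo-+ m (λ j → sumTo n (λ i → a i j)) (a (suc n))))

sumTo-triangle : ∀ n (a : ℕ → ℕ → ℤ) →
  sumTo n (λ i → sumTo i (λ j → a i j)) ≡ sumTo n (λ j → sumTo (n ∸ j) (λ k → a (j ℕ.+ k) j))
sumTo-triangle zero    a = refl
sumTo-triangle (suc n) a = begin
  sumTo n (λ i → sumTo i (a i)) + sumTo (suc n) (a (suc n))
    ≡⟨ cong (_+ sumTo (suc n) (a (suc n))) (sumTo-triangle n a) ⟩
  sumTo n (λ j → column n j) + (sumTo n (a (suc n)) + a (suc n) (suc n))
    ≡⟨ sym (ℤP.+-assoc (sumTo n (column n)) _ _) ⟩
  sumTo n (λ j → column n j) + sumTo n (a (suc n)) + a (suc n) (suc n)
    ≡⟨ cong (_+ a (suc n) (suc n)) (sym (sumTo-+ n (column n) (a (suc n)))) ⟩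
  sumTo n (λ j → column n j + a (suc n) j) + a (suc n) (suc n)
    ≡⟨ cong₂ _+_ (sumTo-cong n extend-column) (cong (λ m → a m (suc n)) (sym (ℕP.+-identityʳ (suc n)))) ⟩
  sumTo n (column (suc n)) + a (suc n ℕ.+ 0) (suc n)
    ≡⟨ cong (λ m → sumTo n (column (suc n)) + sumTo m (λ k → a (suc n ℕ.+ k) (suc n))) (sym (ℕP.n∸n≡0 n)) ⟩
  sumTo (suc n) (column (suc n))
    ∎
  where
  open ≡-Reasoning
  column : ℕ → ℕ → ℤ
  column n j = sumTo (n ∸ j) (λ k → a (j ℕ.+ k) j)
  extend-column : ∀ j → j ≤ n → column n j + a (suc n) j ≡ column (suc n) j
  extend-column j j≤n rewrite ℕP.+-∸-assoc 1 j≤n =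
    cong (λ m → column n j + a m j) (trans (cong suc (sym (ℕP.m+[n∸m]≡n j≤n))) (sym (ℕP.+-suc j (n ∸ j))))

infix 4 _≈_
_≈_ : Series → Series → Set
f ≈ g = ∀ n → f n ≡ g n

constant : ℤ → Series
constant c zero    = c
constant c (suc _) = + 0

-- The ring solver below interprets the numeral 1 as 𝟙, which is only pointwise equal to one.
𝟙 : Series
𝟙 = constant (+ 1)

one≈𝟙 : one ≈ 𝟙
one≈𝟙 zero    = refl
one≈𝟙 (suc _) = refl

negate : Series → Series
negate f n = - f n

infixl 6 _⊖_
_⊖_ : Series → Series → Series
f ⊖ g = f ⊕ negate g

⊕-congˡ : ∀ h {f g} → f ≈ g → h ⊕ f ≈ h ⊕ g
⊕-congˡ h f≈g n = cong (λ x → h n + x) (f≈g n)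

⊕-congʳ : ∀ h {f g} → f ≈ g → f ⊕ h ≈ g ⊕ h
⊕-congʳ h f≈g n = cong (_+ h n) (f≈g n)

⊛-congˡ : ∀ h {f g} → f ≈ g → h ⊛ f ≈ h ⊛ g
⊛-congˡ h f≈g n = sumTo-cong′ n (λ i → cong (h i *_) (f≈g (n ∸ i)))

⊛-congʳ : ∀ h {f g} → f ≈ g → f ⊛ h ≈ g ⊛ h
⊛-congʳ h f≈g n = sumTo-cong′ n (λ i → cong (_* h (n ∸ i)) (f≈g i))

⊛-cong : ∀ {f f′ g g′} → f ≈ f′ → g ≈ g′ → f ⊛ g ≈ f′ ⊛ g′
⊛-cong f≈f′ g≈g′ n = sumTo-cong′ n (λ i → cong₂ _*_ (f≈f′ i) (g≈g′ (n ∸ i)))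

⊛-comm : ∀ f g → f ⊛ g ≈ g ⊛ f
⊛-comm f g n = trans (sumTo-reverse n _) (sumTo-cong n λ i i≤n →
  trans (ℤP.*-comm (f (n ∸ i)) _) (cong (λ k → g k * f (n ∸ i)) (ℕP.m∸[m∸n]≡n i≤n)))

⊛-assoc : ∀ f g h → (f ⊛ g) ⊛ h ≈ f ⊛ (g ⊛ h)
⊛-assoc f g h n = begin
  sumTo n (λ i → sumTo i (λ j → f j * g (i ∸ j)) * h (n ∸ i))
    ≡⟨ sumTo-cong′ n (λ i → sumTo-*ʳ i (h (n ∸ i)) _) ⟩
  sumTo n (λ i → sumTo i (λ j → f j * g (i ∸ j) * h (n ∸ i)))
    ≡⟨ sumTo-triangle n (λ i j → f j * g (i ∸ j) * h (n ∸ i)) ⟩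
  sumTo n (λ j → sumTo (n ∸ j) (λ k → f j * g (j ℕ.+ k ∸ j) * h (n ∸ (j ℕ.+ k))))
    ≡⟨ sumTo-cong′ n (λ j → sumTo-cong′ (n ∸ j) (λ k → trans (ℤP.*-assoc (f j) _ _)
         (cong₂ (λ a b → f j * (g a * h b)) (ℕP.m+n∸m≡n j k) (sym (ℕP.∸-+-assoc n j k))))) ⟩
  sumTo n (λ j → sumTo (n ∸ j) (λ k → f j * (g k * h (n ∸ j ∸ k))))
    ≡⟨ sumTo-cong′ n (λ j → sym (sumTo-*ˡ (n ∸ j) (f j) _)) ⟩
  sumTo n (λ j → f j * sumTo (n ∸ j) (λ k → g k * h (n ∸ j ∸ k)))
    ∎
  where open ≡-Reasoning

⊛-identityˡ : ∀ f → one ⊛ f ≈ f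
⊛-identityˡ f n = trans (sumTo-head n _ (λ i → ℤP.*-zeroˡ (f (n ∸ suc i)))) (ℤP.*-identityˡ (f n))

⊛-identityʳ : ∀ f → f ⊛ one ≈ f
⊛-identityʳ f n = trans (⊛-comm f one n) (⊛-identityˡ f n)

⊛-distribˡ : ∀ f g h → f ⊛ (g ⊕ h) ≈ f ⊛ g ⊕ f ⊛ h
⊛-distribˡ f g h n = trans (sumTo-cong′ n (λ i → ℤP.*-distribˡ-+ (f i) (g (n ∸ i)) (h (n ∸ i)))) (sumTo-+ n _ _)

⊛-distribʳ : ∀ f g h → (g ⊕ h) ⊛ f ≈ g ⊛ f ⊕ h ⊛ f
⊛-distribʳ f g h n = trans (sumTo-cong′ n (λ i → ℤP.*-distribʳ-+ (f (n ∸ i)) (g i) (h i))) (sumTo-+ n _ _)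

seriesRing : CommutativeRing 0ℓ 0ℓ
seriesRing = record
  { Carrier = Series ; _≈_ = _≈_ ; _+_ = _⊕_ ; _*_ = _⊛_ ; -_ = negate ; 0# = λ _ → + 0 ; 1# = one
  ; isCommutativeRing = record
    { isRing = record
      { +-isAbelianGroup = record
        { isGroup = record
          { isMonoid = record
            { isSemigroup = record
              { isMagma = record
                { isEquivalence = record { refl = λ _ → refl ; sym = λ p n → sym (p n) ; trans = λ p q n → trans (p n) (q n) }
                ; ∙-cong = λ p q n → cong₂ _+_ (p n) (q n) }
              ; assoc = λ f g h n → ℤP.+-assoc (f n) (g n) (h n) }
            ; identity = (λ f n → ℤP.+-identityˡ (f n)) , (λ f n → ℤP.+-identityʳ (f n)) }
          ; inverse = (λ f n → ℤP.+-inverseˡ (f n)) , (λ f n → ℤP.+-inverseʳ (f n))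
          ; ⁻¹-cong = λ p n → cong -_ (p n) }
        ; comm = λ f g n → ℤP.+-comm (f n) (g n) }
      ; *-cong = ⊛-cong
      ; *-assoc = ⊛-assoc
      ; *-identity = ⊛-identityˡ , ⊛-identityʳ
      ; distrib = ⊛-distribˡ , ⊛-distribʳ }
    ; *-comm = ⊛-comm } }

constant-⊛ : ∀ a b → constant (a * b) ≈ constant a ⊛ constant b
constant-⊛ a b zero    = refl
constant-⊛ a b (suc m) = sym (sumTo-zero (suc m) _ vanish)
  where
  vanish : ∀ i → i ≤ suc m → constant a i * constant b (suc m ∸ i) ≡ + 0
  vanish zero    _ = ℤP.*-zeroʳ a
  vanish (suc i) _ = ℤP.*-zeroˡ (constant b (m ∸ i))

constant-morphism : ACR._-Raw-AlmostCommutative⟶_ (CommutativeRing.rawRing ℤP.+-*-commutativeRing)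
                                                  (ACR.fromCommutativeRing seriesRing)
constant-morphism = record
  { ⟦_⟧    = constant
  ; +-homo = λ { a b zero → refl ; a b (suc _) → refl }
  ; *-homo = constant-⊛
  ; -‿homo = λ { a zero → refl ; a (suc _) → refl }
  ; 0-homo = λ { zero → refl ; (suc _) → refl }
  ; 1-homo = λ { zero → refl ; (suc _) → refl } }

constant-≟ : ∀ a b → Maybe (constant a ≈ constant b)
constant-≟ a b with a ℤ.≟ b
... | yes refl = just (λ _ → refl)
... | no _     = nothing

open import Algebra.Solver.Ring (CommutativeRing.rawRing ℤP.+-*-commutativeRing)
  (ACR.fromCommutativeRing seriesRing) constant-morphism constant-≟
  using (solve; _:=_; con; _:+_; _:*_; _:-_)

≈-modulo : ∀ {a b c d} p → a ≈ b ⊕ p ⊛ (c ⊖ d) → c ≈ d → a ≈ b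
≈-modulo {a} {b} {c} {d} p a≈ c≈d n = trans (a≈ n) (trans (cong (λ x → b n + x) vanish) (ℤP.+-identityʳ (b n)))
  where
  vanish : (p ⊛ (c ⊖ d)) n ≡ + 0
  vanish = sumTo-zero n _ λ i _ →
    trans (cong (p i *_) (trans (cong (_+ - d (n ∸ i)) (c≈d (n ∸ i))) (ℤP.+-inverseʳ (d (n ∸ i))))) (ℤP.*-zeroʳ (p i))

X⊛-shift : ∀ f n → (X ⊛ f) (suc n) ≡ f n
X⊛-shift f n = begin
  (X ⊛ f) (suc n)                                ≡⟨ sumTo-suc n _ ⟩
  + 0 + sumTo n (λ i → X (suc i) * f (n ∸ i))    ≡⟨ ℤP.+-identityˡ _ ⟩
  sumTo n (λ i → X (suc i) * f (n ∸ i))          ≡⟨ sumTo-head n _ (λ i → ℤP.*-zeroˡ (f (n ∸ suc i))) ⟩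
  + 1 * f n                                      ≡⟨ ℤP.*-identityˡ (f n) ⟩
  f n                                            ∎
  where open ≡-Reasoning

D : Series → Series
D f n = + suc n * f (suc n)

D-cong : ∀ {f g} → f ≈ g → D f ≈ D g
D-cong f≈g n = cong (+ suc n *_) (f≈g (suc n))

D-⊕ : ∀ f g → D (f ⊕ g) ≈ D f ⊕ D g
D-⊕ f g n = ℤP.*-distribˡ-+ (+ suc n) (f (suc n)) (g (suc n))

D-constant : ∀ c n → D (constant c) n ≡ + 0
D-constant c n = ℤP.*-zeroʳ (+ suc n)

D-X : D X ≈ 𝟙
D-X zero    = refl
D-X (suc n) = ℤP.*-zeroʳ (+ suc (suc n))

D-⊛ : ∀ f g → D (f ⊛ g) ≈ D f ⊛ g ⊕ f ⊛ D g
D-⊛ f g n = begin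
  + suc n * sumTo (suc n) h                                                    ≡⟨ sumTo-*ˡ (suc n) (+ suc n) h ⟩
  sumTo (suc n) (λ i → + suc n * h i)                                          ≡⟨ sumTo-cong (suc n) split ⟩
  sumTo (suc n) (λ i → + i * h i + + (suc n ∸ i) * h i)                        ≡⟨ sumTo-+ (suc n) _ _ ⟩
  sumTo (suc n) (λ i → + i * h i) + sumTo (suc n) (λ i → + (suc n ∸ i) * h i)  ≡⟨ cong₂ _+_ left right ⟩
  (D f ⊛ g) n + (f ⊛ D g) n                                                    ∎
  where
  open ≡-Reasoning
  h : ℕ → ℤ
  h i = f i * g (suc n ∸ i)
  split : ∀ i → i ≤ suc n → + suc n * h i ≡ + i * h i + + (suc n ∸ i) * h i
  split i i≤ = trans (cong (λ k → + k * h i) (sym (ℕP.m+[n∸m]≡n i≤))) (ℤP.*-distribʳ-+ (h i) (+ i) (+ (suc n ∸ i)))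
  left : sumTo (suc n) (λ i → + i * h i) ≡ (D f ⊛ g) n
  left = trans (sumTo-suc n _) (trans (ℤP.+-identityˡ _)
    (sumTo-cong′ n (λ i → sym (ℤP.*-assoc (+ suc i) (f (suc i)) (g (n ∸ i))))))
  right : sumTo (suc n) (λ i → + (suc n ∸ i) * h i) ≡ (f ⊛ D g) n
  right = begin
    sumTo n (λ i → + (suc n ∸ i) * h i) + + (suc n ∸ suc n) * h (suc n)
      ≡⟨ cong (λ k → sumTo n (λ i → + (suc n ∸ i) * h i) + + k * h (suc n)) (ℕP.n∸n≡0 n) ⟩
    sumTo n (λ i → + (suc n ∸ i) * h i) + + 0 * h (suc n)
      ≡⟨ ℤP.+-identityʳ _ ⟩
    sumTo n (λ i → + (suc n ∸ i) * h i)
      ≡⟨ sumTo-cong n (λ i i≤n → trans (cong (λ k → + k * (f i * g k)) (ℕP.+-∸-assoc 1 i≤n))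
                                 (x∙yz≈y∙xz (+ suc (n ∸ i)) (f i) (g (suc (n ∸ i))))) ⟩
    (f ⊛ D g) n
      ∎
    where
    x∙yz≈y∙xz : ∀ a b c → a * (b * c) ≡ b * (a * c)
    x∙yz≈y∙xz = solve-∀

X⊛D : ∀ f n → (X ⊛ D f) n ≡ + n * f n
X⊛D f zero    = refl
X⊛D f (suc n) = X⊛-shift (D f) n

module _ (Y : Series) (Y-quadratic : Y ≈ 𝟙 ⊕ X ⊛ Y ⊛ Y) where

  D-quadratic : D Y ≈ (𝟙 ⊛ Y ⊕ X ⊛ D Y) ⊛ Y ⊕ X ⊛ Y ⊛ D Y
  D-quadratic = begin
    D Y                                         ≈⟨ D-cong Y-quadratic ⟩
    D (𝟙 ⊕ X ⊛ Y ⊛ Y)                           ≈⟨ D-⊕ 𝟙 (X ⊛ Y ⊛ Y) ⟩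
    D 𝟙 ⊕ D (X ⊛ Y ⊛ Y)                         ≈⟨ (λ n → trans (cong (_+ D (X ⊛ Y ⊛ Y) n) (D-constant (+ 1) n)) (ℤP.+-identityˡ _)) ⟩
    D (X ⊛ Y ⊛ Y)                               ≈⟨ D-⊛ (X ⊛ Y) Y ⟩
    D (X ⊛ Y) ⊛ Y ⊕ X ⊛ Y ⊛ D Y                 ≈⟨ ⊕-congʳ (X ⊛ Y ⊛ D Y) (⊛-congʳ Y (D-⊛ X Y)) ⟩
    (D X ⊛ Y ⊕ X ⊛ D Y) ⊛ Y ⊕ X ⊛ Y ⊛ D Y       ≈⟨ ⊕-congʳ (X ⊛ Y ⊛ D Y) (⊛-congʳ Y (⊕-congʳ (X ⊛ D Y) (⊛-congʳ Y D-X))) ⟩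
    (𝟙 ⊛ Y ⊕ X ⊛ D Y) ⊛ Y ⊕ X ⊛ Y ⊛ D Y         ∎
    where open SetoidReasoning (CommutativeRing.setoid seriesRing)

  quadratic-ode : X ⊛ D Y ⊕ Y ≈ 𝟙 ⊕ X ⊛ (Y ⊕ Y ⊕ X ⊛ D Y ⊕ X ⊛ D Y ⊕ X ⊛ D Y ⊕ X ⊛ D Y)
  quadratic-ode = ≈-modulo q (≈-modulo p identity D-quadratic) Y-quadratic
    where
    p q : Series
    p = X ⊛ (𝟙 ⊖ (X ⊕ X) ⊛ Y)
    q = X ⊛ (X ⊛ D Y) ⊕ X ⊛ (X ⊛ D Y) ⊕ X ⊛ (X ⊛ D Y) ⊕ X ⊛ (X ⊛ D Y) ⊕ 𝟙 ⊕ (X ⊕ X) ⊛ Y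
    identity : X ⊛ D Y ⊕ Y ≈ 𝟙 ⊕ X ⊛ (Y ⊕ Y ⊕ X ⊛ D Y ⊕ X ⊛ D Y ⊕ X ⊛ D Y ⊕ X ⊛ D Y)
                               ⊕ q ⊛ (Y ⊖ (𝟙 ⊕ X ⊛ Y ⊛ Y))
                               ⊕ p ⊛ (D Y ⊖ ((𝟙 ⊛ Y ⊕ X ⊛ D Y) ⊛ Y ⊕ X ⊛ Y ⊛ D Y))
    identity = solve 3 (λ x y d →
      x :* d :+ y
        := con (+ 1) :+ x :* (y :+ y :+ x :* d :+ x :* d :+ x :* d :+ x :* d)
           :+ (x :* (x :* d) :+ x :* (x :* d) :+ x :* (x :* d) :+ x :* (x :* d) :+ con (+ 1) :+ (x :+ x) :* y)
              :* (y :- (con (+ 1) :+ x :* y :* y))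
           :+ x :* (con (+ 1) :- (x :+ x) :* y)
              :* (d :- ((con (+ 1) :* y :+ x :* d) :* y :+ x :* y :* d)))
      (λ _ → refl) X Y (D Y)

  quadratic-recurrence : ∀ n → (+ 2 + + n) * Y (suc n) ≡ (+ 4 * + n + + 2) * Y n
  quadratic-recurrence n = begin
    (+ 2 + + n) * Y (suc n)                         ≡⟨ split-off (+ n) (Y (suc n)) ⟩
    + suc n * Y (suc n) + Y (suc n)                 ≡⟨ cong (_+ Y (suc n)) (sym (X⊛D Y (suc n))) ⟩
    (X ⊛ D Y ⊕ Y) (suc n)                           ≡⟨ quadratic-ode (suc n) ⟩
    + 0 + (X ⊛ W) (suc n)                           ≡⟨ trans (ℤP.+-identityˡ _) (X⊛-shift W n) ⟩
    W n                                             ≡⟨ cong (λ e → Y n + Y n + e + e + e + e) (X⊛D Y n) ⟩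
    Y n + Y n + + n * Y n + + n * Y n + + n * Y n + + n * Y n ≡⟨ collect (+ n) (Y n) ⟩
    (+ 4 * + n + + 2) * Y n                         ∎
    where
    open ≡-Reasoning
    W = Y ⊕ Y ⊕ X ⊛ D Y ⊕ X ⊛ D Y ⊕ X ⊛ D Y ⊕ X ⊛ D Y
    split-off : ∀ m y → (+ 2 + m) * y ≡ (+ 1 + m) * y + y
    split-off = solve-∀
    collect : ∀ m y → y + y + m * y + m * y + m * y + m * y ≡ (+ 4 * m + + 2) * y
    collect = solve-∀

catalan-recurrenceℤ : ∀ n → (+ 4 * + n + + 2) * + catalan n ≡ (+ 2 + + n) * + catalan (suc n)
catalan-recurrenceℤ n = begin
  (+ 4 * + n + + 2) * + catalan n      ≡⟨ cong (λ k → (k + + 2) * + catalan n) (sym (ℤP.pos-* 4 n)) ⟩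
  (+ (4 ℕ.* n) + + 2) * + catalan n    ≡⟨ cong (_* + catalan n) (sym (ℤP.pos-+ (4 ℕ.* n) 2)) ⟩
  + (4 ℕ.* n ℕ.+ 2) * + catalan n      ≡⟨ sym (ℤP.pos-* (4 ℕ.* n ℕ.+ 2) (catalan n)) ⟩
  + ((4 ℕ.* n ℕ.+ 2) ℕ.* catalan n)    ≡⟨ cong +_ (sym (catalan-recurrence n)) ⟩
  + ((2 ℕ.+ n) ℕ.* catalan (suc n))    ≡⟨ ℤP.pos-* (2 ℕ.+ n) (catalan (suc n)) ⟩
  (+ 2 + + n) * + catalan (suc n)      ∎
  where open ≡-Reasoning

quadratic⇒B : ∀ Y → Y ≈ 𝟙 ⊕ X ⊛ Y ⊛ Y → Y ≈ B
quadratic⇒B Y Y-quadratic zero    = Y-quadratic 0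
quadratic⇒B Y Y-quadratic (suc n) = ℤP.*-cancelˡ-≡ (+ 2 + + n) (Y (suc n)) (B (suc n)) (begin
  (+ 2 + + n) * Y (suc n)              ≡⟨ quadratic-recurrence Y Y-quadratic n ⟩
  (+ 4 * + n + + 2) * Y n              ≡⟨ cong ((+ 4 * + n + + 2) *_) (quadratic⇒B Y Y-quadratic n) ⟩
  (+ 4 * + n + + 2) * + catalan n      ≡⟨ catalan-recurrenceℤ n ⟩
  (+ 2 + + n) * + catalan (suc n)      ∎)
  where open ≡-Reasoning

module _ (G : Series) (G-order : G 0 ≡ + 0) where

  pow-vanishes : ∀ k n → n < k → pow G k n ≡ + 0
  pow-vanishes (suc k) zero    _         = trans (cong (_* pow G k 0) G-order) (ℤP.*-zeroˡ (pow G k 0))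
  pow-vanishes (suc k) (suc m) (s≤s m<k) = begin
    (G ⊛ pow G k) (suc m)                                      ≡⟨ sumTo-suc m _ ⟩
    G 0 * pow G k (suc m) + sumTo m (λ i → G (suc i) * pow G k (m ∸ i))
      ≡⟨ cong₂ _+_ (trans (cong (_* pow G k (suc m)) G-order) (ℤP.*-zeroˡ (pow G k (suc m))))
                   (sumTo-zero m _ (λ i _ → trans (cong (G (suc i) *_) (pow-vanishes k (m ∸ i) (ℕP.≤-<-trans (ℕP.m∸n≤m m i) m<k)))
                                                   (ℤP.*-zeroʳ (G (suc i))))) ⟩
    + 0                                                        ∎
    where open ≡-Reasoning

  compose-extend : ∀ F n N → n ≤ N → sumTo N (λ k → F k * pow G k n) ≡ compose F G n
  compose-extend F n N n≤N = sumTo-extend N _ n≤N (λ k n<k → trans (cong (F k *_) (pow-vanishes k n n<k)) (ℤP.*-zeroʳ (F k)))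

  pow-+ : ∀ i j → pow G (i ℕ.+ j) ≈ pow G i ⊛ pow G j
  pow-+ zero    j n = sym (⊛-identityˡ (pow G j) n)
  pow-+ (suc i) j n = trans (⊛-congˡ G (pow-+ i j) n) (sym (⊛-assoc G (pow G i) (pow G j) n))

  compose-cong : ∀ {F F′} → F ≈ F′ → compose F G ≈ compose F′ G
  compose-cong F≈F′ n = sumTo-cong′ n (λ k → cong (_* pow G k n) (F≈F′ k))

  compose-constant : ∀ c → compose (constant c) G ≈ constant c
  compose-constant c n = trans (sumTo-head n _ (λ k → ℤP.*-zeroˡ (pow G (suc k) n))) (c*one n)
    where
    c*one : ∀ n → c * one n ≡ constant c n
    c*one zero    = ℤP.*-identityʳ c
    c*one (suc _) = ℤP.*-zeroʳ c

  compose-X : compose X G ≈ G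
  compose-X zero    = sym G-order
  compose-X (suc m) = begin
    compose X G (suc m)                            ≡⟨ sumTo-suc m _ ⟩
    + 0 + sumTo m (λ k → X (suc k) * pow G (suc k) (suc m))
      ≡⟨ trans (ℤP.+-identityˡ _) (sumTo-head m _ (λ k → ℤP.*-zeroˡ (pow G (suc (suc k)) (suc m)))) ⟩
    + 1 * (G ⊛ one) (suc m)                        ≡⟨ trans (ℤP.*-identityˡ _) (⊛-identityʳ G (suc m)) ⟩
    G (suc m)                                      ∎
    where open ≡-Reasoning

  compose-⊕ : ∀ F H → compose (F ⊕ H) G ≈ compose F G ⊕ compose H G
  compose-⊕ F H n = trans (sumTo-cong′ n (λ k → ℤP.*-distribʳ-+ (pow G k n) (F k) (H k))) (sumTo-+ n _ _)

  compose-⊛ : ∀ F H → compose (F ⊛ H) G ≈ compose F G ⊛ compose H G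
  compose-⊛ F H n = trans expand-left (sym expand-right)
    where
    open ≡-Reasoning
    double-sum : ℤ
    double-sum = sumTo n (λ i → sumTo n (λ j → F i * H j * pow G (i ℕ.+ j) n))
    expand-left : compose (F ⊛ H) G n ≡ double-sum
    expand-left = begin
      sumTo n (λ k → sumTo k (λ i → F i * H (k ∸ i)) * pow G k n)
        ≡⟨ sumTo-cong′ n (λ k → sumTo-*ʳ k (pow G k n) _) ⟩
      sumTo n (λ k → sumTo k (λ i → F i * H (k ∸ i) * pow G k n))
        ≡⟨ sumTo-triangle n (λ k i → F i * H (k ∸ i) * pow G k n) ⟩
      sumTo n (λ i → sumTo (n ∸ i) (λ j → F i * H (i ℕ.+ j ∸ i) * pow G (i ℕ.+ j) n))
        ≡⟨ sumTo-cong′ n (λ i → sumTo-cong′ (n ∸ i) (λ j → cong (λ k → F i * H k * pow G (i ℕ.+ j) n) (ℕP.m+n∸m≡n i j))) ⟩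
      sumTo n (λ i → sumTo (n ∸ i) (λ j → F i * H j * pow G (i ℕ.+ j) n))
        ≡⟨ sumTo-cong n (λ i i≤n → sym (sumTo-extend n _ (ℕP.m∸n≤m n i) (λ j n∸i<j →
             trans (cong (F i * H j *_) (pow-vanishes (i ℕ.+ j) n (n<i+j i≤n n∸i<j))) (ℤP.*-zeroʳ (F i * H j))))) ⟩
      double-sum
        ∎
      where
      n<i+j : ∀ {i j} → i ≤ n → n ∸ i < j → n < i ℕ.+ j
      n<i+j {i} i≤n n∸i<j = ℕP.≤-trans (ℕP.≤-reflexive (trans (cong suc (sym (ℕP.m+[n∸m]≡n i≤n))) (sym (ℕP.+-suc i (n ∸ i)))))
                                       (ℕP.+-monoʳ-≤ i n∸i<j)
    expand-right : (compose F G ⊛ compose H G) n ≡ double-sum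
    expand-right = begin
      sumTo n (λ a → compose F G a * compose H G (n ∸ a))
        ≡⟨ sumTo-cong n (λ a a≤n → sym (cong₂ _*_ (compose-extend F a n a≤n) (compose-extend H (n ∸ a) n (ℕP.m∸n≤m n a)))) ⟩
      sumTo n (λ a → sumTo n (λ i → F i * pow G i a) * sumTo n (λ j → H j * pow G j (n ∸ a)))
        ≡⟨ sumTo-cong′ n (λ a → trans (sumTo-*ʳ n _ _) (sumTo-cong′ n (λ i → sumTo-*ˡ n (F i * pow G i a) _))) ⟩
      sumTo n (λ a → sumTo n (λ i → sumTo n (λ j → F i * pow G i a * (H j * pow G j (n ∸ a)))))
        ≡⟨ trans (sumTo-swap n n _) (sumTo-cong′ n (λ i → sumTo-swap n n _)) ⟩
      sumTo n (λ i → sumTo n (λ j → sumTo n (λ a → F i * pow G i a * (H j * pow G j (n ∸ a)))))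
        ≡⟨ sumTo-cong′ n (λ i → sumTo-cong′ n (λ j → trans (sumTo-cong′ n (λ a → interchange (F i) (pow G i a) (H j) _))
                                                           (sym (sumTo-*ˡ n (F i * H j) _)))) ⟩
      sumTo n (λ i → sumTo n (λ j → F i * H j * (pow G i ⊛ pow G j) n))
        ≡⟨ sumTo-cong′ n (λ i → sumTo-cong′ n (λ j → cong (F i * H j *_) (sym (pow-+ i j n)))) ⟩
      double-sum
        ∎
      where
      interchange : ∀ a b c d → a * b * (c * d) ≡ a * c * (b * d)
      interchange = solve-∀

  compose-quadratic : ∀ Y → Y ≈ 𝟙 ⊕ X ⊛ Y ⊛ Y → compose Y G ≈ 𝟙 ⊕ G ⊛ compose Y G ⊛ compose Y G
  compose-quadratic Y Y-quadratic = begin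
    compose Y G                                          ≈⟨ compose-cong Y-quadratic ⟩
    compose (𝟙 ⊕ X ⊛ Y ⊛ Y) G                            ≈⟨ compose-⊕ 𝟙 (X ⊛ Y ⊛ Y) ⟩
    compose 𝟙 G ⊕ compose (X ⊛ Y ⊛ Y) G                  ≈⟨ ⊕-congʳ _ (compose-constant (+ 1)) ⟩
    𝟙 ⊕ compose (X ⊛ Y ⊛ Y) G                            ≈⟨ ⊕-congˡ 𝟙 (compose-⊛ (X ⊛ Y) Y) ⟩
    𝟙 ⊕ compose (X ⊛ Y) G ⊛ compose Y G                  ≈⟨ ⊕-congˡ 𝟙 (⊛-congʳ (compose Y G) (compose-⊛ X Y)) ⟩
    𝟙 ⊕ compose X G ⊛ compose Y G ⊛ compose Y G          ≈⟨ ⊕-congˡ 𝟙 (⊛-congʳ (compose Y G) (⊛-congʳ (compose Y G) compose-X)) ⟩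
    𝟙 ⊕ G ⊛ compose Y G ⊛ compose Y G                    ∎
    where open SetoidReasoning (CommutativeRing.setoid seriesRing)

-- segner k n runs Segner's recurrence C (n + 1) = Σ C i C (n - i) with recursion depth k; it is exact once n < k.
segner : ℕ → ℕ → ℤ
segner zero    _       = + 0
segner (suc k) zero    = + 1
segner (suc k) (suc n) = sumTo n (λ i → segner k i * segner k (n ∸ i))

segner-depth : ∀ k l n → n < k → n < l → segner k n ≡ segner l n
segner-depth (suc k) (suc l) zero    _         _         = refl
segner-depth (suc k) (suc l) (suc n) (s≤s n<k) (s≤s n<l) = sumTo-cong n (λ i i≤n → cong₂ _*_
  (segner-depth k l i (ℕP.≤-<-trans i≤n n<k) (ℕP.≤-<-trans i≤n n<l))
  (segner-depth k l (n ∸ i) (ℕP.≤-<-trans (ℕP.m∸n≤m n i) n<k) (ℕP.≤-<-trans (ℕP.m∸n≤m n i) n<l)))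

segnerSeries : Series
segnerSeries n = segner (suc n) n

segnerSeries-quadratic : segnerSeries ≈ 𝟙 ⊕ X ⊛ segnerSeries ⊛ segnerSeries
segnerSeries-quadratic zero    = refl
segnerSeries-quadratic (suc n) = begin
  sumTo n (λ i → segner (suc n) i * segner (suc n) (n ∸ i))   ≡⟨ sumTo-cong n (λ i i≤n → cong₂ _*_
      (segner-depth (suc n) (suc i) i (s≤s i≤n) ℕP.≤-refl)
      (segner-depth (suc n) (suc (n ∸ i)) (n ∸ i) (s≤s (ℕP.m∸n≤m n i)) ℕP.≤-refl)) ⟩
  (segnerSeries ⊛ segnerSeries) n                              ≡⟨ sym (X⊛-shift (segnerSeries ⊛ segnerSeries) n) ⟩
  (X ⊛ (segnerSeries ⊛ segnerSeries)) (suc n)                  ≡⟨ sym (⊛-assoc X segnerSeries segnerSeries (suc n)) ⟩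
  (X ⊛ segnerSeries ⊛ segnerSeries) (suc n)                    ≡⟨ sym (ℤP.+-identityˡ _) ⟩
  (𝟙 ⊕ X ⊛ segnerSeries ⊛ segnerSeries) (suc n)               ∎
  where open ≡-Reasoning

B-quadratic : B ≈ 𝟙 ⊕ X ⊛ B ⊛ B
B-quadratic n = begin
  B n                                          ≡⟨ sym (S≈B n) ⟩
  segnerSeries n                               ≡⟨ segnerSeries-quadratic n ⟩
  (𝟙 ⊕ X ⊛ segnerSeries ⊛ segnerSeries) n      ≡⟨ ⊕-congˡ 𝟙 (⊛-cong (⊛-congˡ X S≈B) S≈B) n ⟩
  (𝟙 ⊕ X ⊛ B ⊛ B) n                            ∎
  where
  open ≡-Reasoning
  S≈B : segnerSeries ≈ B
  S≈B = quadratic⇒B segnerSeries segnerSeries-quadratic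

geometric-1-2z : ∀ I → oneMinus2z ⊛ I ≈ one → I ≈ 𝟙 ⊕ (X ⊕ X) ⊛ I
geometric-1-2z I inverse = ≈-modulo 𝟙 identity relation
  where
  identity : I ≈ 𝟙 ⊕ (X ⊕ X) ⊛ I ⊕ 𝟙 ⊛ ((𝟙 ⊖ (X ⊕ X)) ⊛ I ⊖ 𝟙)
  identity = solve 2 (λ x i → i := con (+ 1) :+ (x :+ x) :* i :+ con (+ 1) :* ((con (+ 1) :- (x :+ x)) :* i :- con (+ 1)))
                     (λ _ → refl) X I
  1-2z : 𝟙 ⊖ (X ⊕ X) ≈ oneMinus2z
  1-2z zero          = refl
  1-2z (suc zero)    = refl
  1-2z (suc (suc n)) = refl
  relation : (𝟙 ⊖ (X ⊕ X)) ⊛ I ≈ 𝟙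
  relation n = trans (⊛-congʳ I 1-2z n) (trans (inverse n) (one≈𝟙 n))

quadratic-substitution : ∀ I G u → I ≈ 𝟙 ⊕ (X ⊕ X) ⊛ I → G ≈ X ⊛ X ⊛ (I ⊛ I) → u ≈ 𝟙 ⊕ G ⊛ u ⊛ u →
                         𝟙 ⊕ X ⊛ I ⊛ u ≈ 𝟙 ⊕ X ⊛ (𝟙 ⊕ X ⊛ I ⊛ u) ⊛ (𝟙 ⊕ X ⊛ I ⊛ u)
quadratic-substitution I G u I-eq G-eq u-eq =
  ≈-modulo (X ⊛ u ⊛ u) (≈-modulo (X ⊛ u) (≈-modulo X identity u-eq) I-eq) G-eq
  where
  identity : 𝟙 ⊕ X ⊛ I ⊛ u ≈ 𝟙 ⊕ X ⊛ (𝟙 ⊕ X ⊛ I ⊛ u) ⊛ (𝟙 ⊕ X ⊛ I ⊛ u)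
                              ⊕ X ⊛ u ⊛ u ⊛ (G ⊖ X ⊛ X ⊛ (I ⊛ I))
                              ⊕ X ⊛ u ⊛ (I ⊖ (𝟙 ⊕ (X ⊕ X) ⊛ I))
                              ⊕ X ⊛ (u ⊖ (𝟙 ⊕ G ⊛ u ⊛ u))
  identity = solve 4 (λ x i g u →
    con (+ 1) :+ x :* i :* u
      := con (+ 1) :+ x :* (con (+ 1) :+ x :* i :* u) :* (con (+ 1) :+ x :* i :* u)
         :+ x :* u :* u :* (g :- x :* x :* (i :* i))
         :+ x :* u :* (i :- (con (+ 1) :+ (x :+ x) :* i))
         :+ x :* (u :- (con (+ 1) :+ g :* u :* u)))
    (λ _ → refl) X I G u

pow-2 : ∀ f → pow f 2 ≈ f ⊛ f
pow-2 f = ⊛-congˡ f (⊛-identityʳ f)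

proposition2p1 : (I : Series) → (∀ n → (oneMinus2z ⊛ I) n ≡ one n) →
    ∀ n → B n ≡ (one ⊕ X ⊛ I ⊛ compose B (pow X 2 ⊛ pow I 2)) n
proposition2p1 I inverse n = begin
  B n                    ≡⟨ sym (quadratic⇒B T T-quadratic n) ⟩
  T n                    ≡⟨ ⊕-congʳ (X ⊛ I ⊛ u) one≈𝟙 n ⟨
  (one ⊕ X ⊛ I ⊛ u) n    ∎
  where
  open ≡-Reasoning
  G = pow X 2 ⊛ pow I 2
  u = compose B G
  T = 𝟙 ⊕ X ⊛ I ⊛ u
  T-quadratic : T ≈ 𝟙 ⊕ X ⊛ T ⊛ T
  T-quadratic = quadratic-substitution I G u (geometric-1-2z I inverse) (⊛-cong (pow-2 X) (pow-2 I))
                                       (compose-quadratic G refl B B-quadratic)
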